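{- Let $(a,b)$ and $(a',b)$ be two different lists of pairs of nonnegative integers of length $n$ such that $a$ is obtained from $a'$ by a unit $(i,j)$-transfer. Then $N_1(a,b)\ge N_1(a',b)$. If moreover $(a',b)$ is loop-digraphic, then $N_1(a,b)>N_1(a',b)$.
   Context: $(a,b)$ denotes the list $((a_1,b_1),\dots,(a_n,b_n))$. A loop-digraph realization of $(a,b)$ is a digraph without multiple arcs and with at most one loop per vertex on the labeled vertex set $v_1,\dots,v_n$ with indegree $a_i$ and outdegree $b_i$ at $v_i$ (a loop counts for both); equivalently an $n\times n$ $(0,1)$-matrix with row sums $b_i$ and column sums $a_i$. $(a,b)$ is loop-digraphic if it has a realization, and $N_1(a,b)$ is the number of its loop-digraph realizations ($0$ if none). Unit $(i,j)$-transfer: for $1\le i<j\le n$ with $a'_i\ge a'_j+2$, the list $a'-e_i+e_j$ ($e_i$ the $i$th unit vector). -}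

module Defs where

open import Data.Nat using (ℕ; zero; suc; _+_; _≤_; pred)
open import Data.Bool using (Bool; true; false)
open import Data.Fin using (Fin; _<_)
open import Data.List using (List; []; _∷_; length; filter; concatMap; map)
open import Data.Vec using (Vec; []; _∷_; lookup; tabulate; _[_]%=_)
open import Data.Vec.Properties using (≡-dec)
open import Data.Product using (Σ; _×_; _,_)
open import Relation.Binary.PropositionalEquality using (_≡_)
open import Relation.Nullary using (Dec; yes; no)
open import Relation.Nullary.Decidable using (_×-dec_)
import Data.Nat as ℕ

-- A (0,1)-matrix of size n×n, given as a vector of rows.
-- Entry M[i][j] = true means the arc v_i → v_j (i = j: a loop at v_i).
Matrix : ℕ → Set
Matrix n = Vec (Vec Bool n) n

entry : ∀ {n} → Matrix n → Fin n → Fin n → Bool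
entry M i j = lookup (lookup M i) j

b2n : Bool → ℕ
b2n true  = 1
b2n false = 0

sumFin : ∀ n → (Fin n → ℕ) → ℕ
sumFin zero    f = 0
sumFin (suc n) f = f Data.Fin.zero + sumFin n (λ k → f (Data.Fin.suc k))

-- row sums = outdegrees, column sums = indegrees
rowSums : ∀ {n} → Matrix n → Vec ℕ n
rowSums {n} M = tabulate (λ i → sumFin n (λ j → b2n (entry M i j)))

colSums : ∀ {n} → Matrix n → Vec ℕ n
colSums {n} M = tabulate (λ j → sumFin n (λ i → b2n (entry M i j)))

IsRealization : ∀ {n} → Vec ℕ n → Vec ℕ n → Matrix n → Set
IsRealization a b M = (colSums M ≡ a) × (rowSums M ≡ b)

isRealization? : ∀ {n} (a b : Vec ℕ n) (M : Matrix n) → Dec (IsRealization a b M)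
isRealization? a b M = ≡-dec ℕ._≟_ (colSums M) a ×-dec ≡-dec ℕ._≟_ (rowSums M) b

LoopDigraphic : ∀ {n} → Vec ℕ n → Vec ℕ n → Set
LoopDigraphic {n} a b = Σ (Matrix n) (IsRealization a b)

allVecs : ∀ {A : Set} → List A → (m : ℕ) → List (Vec A m)
allVecs xs zero    = [] ∷ []
allVecs xs (suc m) = concatMap (λ x → map (x ∷_) (allVecs xs m)) xs

allMatrices : ∀ n → List (Matrix n)
allMatrices n = allVecs (allVecs (true ∷ false ∷ []) n) n

N₁ : ∀ {n} → Vec ℕ n → Vec ℕ n → ℕ
N₁ {n} a b = length (filter (isRealization? a b) (allMatrices n))

UnitTransfer : ∀ {n} → Fin n → Fin n → Vec ℕ n → Vec ℕ n → Set
UnitTransfer i j a' a =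
  (i < j) × (lookup a' j + 2 ≤ lookup a' i) × (a ≡ ((a' [ i ]%= pred) [ j ]%= suc))

module Submission where

-- Only columns i and j of a realization change.  Read them as a word of cells
-- (M r i , M r j), one per row, and match every i-only row (1,0) with the nearest
-- unmatched j-only row (0,1) below it.  As column i exceeds column j by at least
-- two, some i-only row is unmatched; turning the topmost one into (0,1) moves a
-- unit from column i to column j, keeps every row sum, and is undone by turning the
-- topmost unmatched j-only row back, so it injects the realizations of (a′,b) into
-- those of (a,b).  Its image always has an unmatched j-only row, while rearranging
-- the rows of type (1,0) or (0,1) of any realization so that all but one of its
-- i-only rows come first gives a realization of (a,b) without one; hence the
-- inequality is strict as soon as (a′,b) is loop-digraphic.

open import Data.Bool using (Bool; true; false; _∧_; not; _xor_)
open import Data.Fin using (Fin; zero; suc)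
open import Data.Fin.Properties using (_≟_; suc-injective; <⇒≢)
open import Data.List using (List; []; _∷_; length; filter; _++_; concatMap; cartesianProductWith)
import Data.List as List
open import Data.List.Properties using (length-map; length-removeAt′)
open import Data.List.Membership.Propositional using (_∈_)
open import Data.List.Membership.Propositional.Properties
  using (∈-filter⁺; ∈-filter⁻; ∈-map⁻; ∈-cartesianProductWith⁺)
open import Data.List.Relation.Binary.Subset.Propositional using (_⊆_)
open import Data.List.Relation.Unary.All as All using (All)
open import Data.List.Relation.Unary.All.Properties using (map⁺)
open import Data.List.Relation.Unary.AllPairs using ([]; _∷_)
open import Data.List.Relation.Unary.Any using (here; there; _─_)
open import Data.List.Relation.Unary.Unique.Propositional using (Unique)
import Data.List.Relation.Unary.Unique.Propositional.Properties as Unique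
open import Data.Nat using (ℕ; zero; suc; pred; _+_; _∸_; _≤_; _<_; z≤n; s≤s)
open import Data.Nat.Properties
  using (+-suc; +-comm; +-assoc; +-cancelˡ-≤; +-cancelʳ-≡; ≤-reflexive; ≤-trans; <⇒≤; <⇒≱; n≤1+n; m≤m+n;
         m≤n+m; 0∸n≡0; pred[m∸n]≡m∸[1+n]; m+n∸m≡n; m≤n⇒m∸n≡0)
open import Data.Nat.Tactic.RingSolver using (solve-∀)
open import Data.Product using (Σ; _×_; _,_; proj₁; proj₂; ∃)
open import Data.Vec using (Vec; []; _∷_; lookup; tabulate; map; _[_]%=_)
open import Data.Vec.Properties
  using (∷-injective; lookup∘tabulate; tabulate-cong; lookup-map; lookup∘updateAt; lookup∘updateAt′)
import Data.Vec.Functional as Vector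
open import Data.Vec.Functional.Properties using (updateAt-updates; updateAt-minimal)
open import Data.Vec.Relation.Binary.Pointwise.Extensional using (ext; Pointwise-≡⇒≡)
open import Function using (_∘_; const; case_of_)
open import Level using (0ℓ)
open import Relation.Binary.PropositionalEquality
open import Relation.Nullary using (yes; no; contradiction)
open import Relation.Unary using (Pred; Decidable)
open import Defs

-- Counting with duplicate-free lists

module _ {A : Set} where

  ∈-─ : ∀ {x y} {ys : List A} (x∈ys : x ∈ ys) → y ∈ ys → y ≢ x → y ∈ (ys ─ x∈ys)
  ∈-─ (here refl) (here refl) y≢x = contradiction refl y≢x
  ∈-─ (here refl) (there y∈ys) _ = y∈ys
  ∈-─ (there _) (here refl) _ = here refl
  ∈-─ (there x∈ys) (there y∈ys) y≢x = there (∈-─ x∈ys y∈ys y≢x)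

  Unique-⊆⇒length-≤ : ∀ {xs ys : List A} → Unique xs → xs ⊆ ys → length xs ≤ length ys
  Unique-⊆⇒length-≤ {[]} _ _ = z≤n
  Unique-⊆⇒length-≤ {x ∷ xs} {ys} (x∉xs ∷ xs!) xs⊆ys = ≤-trans
    (s≤s (Unique-⊆⇒length-≤ xs! λ y∈xs →
      ∈-─ x∈ys (xs⊆ys (there y∈xs)) (All.lookup x∉xs y∈xs ∘ sym)))
    (≤-reflexive (sym (length-removeAt′ ys _)))
    where x∈ys = xs⊆ys (here refl)

module _ {A B : Set} (f : A → B) where

  Unique-map-injectiveOn : ∀ {xs : List A} → Unique xs →
    (∀ {x y} → x ∈ xs → y ∈ xs → f x ≡ f y → x ≡ y) → Unique (List.map f xs)
  Unique-map-injectiveOn {[]} [] _ = []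
  Unique-map-injectiveOn {x ∷ xs} (x∉xs ∷ xs!) f-inj =
    map⁺ (All.tabulate λ y∈xs fx≡fy → All.lookup x∉xs y∈xs (f-inj (here refl) (there y∈xs) fx≡fy))
    ∷ Unique-map-injectiveOn xs! (λ x∈ y∈ → f-inj (there x∈) (there y∈))

module FilterInjection {A B : Set} {P : Pred A 0ℓ} {Q : Pred B 0ℓ} (P? : Decidable P) (Q? : Decidable Q)
         {xs : List A} {ys : List B} (xs! : Unique xs) (ys-complete : ∀ y → y ∈ ys)
         (f : A → B) (f-resp : ∀ {x} → P x → Q (f x))
         (f-inj : ∀ {x y} → P x → P y → f x ≡ f y → x ≡ y) where

  private
    image : List B
    image = List.map f (filter P? xs)

    P-filter : ∀ {x} → x ∈ filter P? xs → P x
    P-filter = proj₂ ∘ ∈-filter⁻ P? {xs = xs}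

    image! : Unique image
    image! = Unique-map-injectiveOn f (Unique.filter⁺ P? xs!)
      λ x∈ y∈ → f-inj (P-filter x∈) (P-filter y∈)

    image⊆ : image ⊆ filter Q? ys
    image⊆ z∈image with _ , x∈ , refl ← ∈-map⁻ f z∈image =
      ∈-filter⁺ Q? (ys-complete _) (f-resp (P-filter x∈))

    length-image : length image ≡ length (filter P? xs)
    length-image = length-map f (filter P? xs)

  length-filter-≤ : length (filter P? xs) ≤ length (filter Q? ys)
  length-filter-≤ = subst (_≤ _) length-image (Unique-⊆⇒length-≤ image! image⊆)

  length-filter-< : ∀ z → Q z → (∀ x → P x → f x ≢ z) →
    length (filter P? xs) < length (filter Q? ys)
  length-filter-< z Qz z∉image = subst (_< _) length-image (Unique-⊆⇒length-≤ (z∉ ∷ image!) ⊆)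
    where
    z∉ : All (z ≢_) image
    z∉ = All.tabulate λ z′∈image z≡z′ → case ∈-map⁻ f z′∈image of λ where
      (x , x∈ , refl) → z∉image x (P-filter x∈) (sym z≡z′)
    ⊆ : (z ∷ image) ⊆ filter Q? ys
    ⊆ (here refl) = ∈-filter⁺ Q? (ys-complete z) Qz
    ⊆ (there z′∈) = image⊆ z′∈

module _ {A : Set} where

  concatMap-cons≡cartesianProductWith : ∀ {m} (xs : List A) (vs : List (Vec A m)) →
    concatMap (λ x → List.map (x ∷_) vs) xs ≡ cartesianProductWith _∷_ xs vs
  concatMap-cons≡cartesianProductWith [] vs = refl
  concatMap-cons≡cartesianProductWith (x ∷ xs) vs =
    cong (List.map (x ∷_) vs ++_) (concatMap-cons≡cartesianProductWith xs vs)

  allVecs-suc : ∀ (xs : List A) m → allVecs xs (suc m) ≡ cartesianProductWith _∷_ xs (allVecs xs m)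
  allVecs-suc xs m = concatMap-cons≡cartesianProductWith xs (allVecs xs m)

  Unique-allVecs : ∀ {xs : List A} → Unique xs → ∀ m → Unique (allVecs xs m)
  Unique-allVecs xs! zero = All.[] ∷ []
  Unique-allVecs {xs} xs! (suc m) = subst Unique (sym (allVecs-suc xs m))
    (Unique.cartesianProductWith⁺ _∷_ ∷-injective xs! (Unique-allVecs xs! m))

  ∈-allVecs : ∀ {xs : List A} → (∀ x → x ∈ xs) → ∀ {m} (v : Vec A m) → v ∈ allVecs xs m
  ∈-allVecs xs-complete [] = here refl
  ∈-allVecs {xs} xs-complete {suc m} (x ∷ v) = subst (_ ∈_) (sym (allVecs-suc xs m))
    (∈-cartesianProductWith⁺ _∷_ (xs-complete x) (∈-allVecs xs-complete v))

Unique-allMatrices : ∀ n → Unique (allMatrices n)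
Unique-allMatrices n = Unique-allVecs (Unique-allVecs Unique-bools n) n
  where
  Unique-bools : Unique (true ∷ false ∷ [])
  Unique-bools = ((λ ()) All.∷ All.[]) ∷ All.[] ∷ []

∈-allMatrices : ∀ {n} (M : Matrix n) → M ∈ allMatrices n
∈-allMatrices = ∈-allVecs (∈-allVecs λ { true → here refl ; false → there (here refl) })

-- Words of column pairs

Cell : Set
Cell = Bool × Bool

Word : ℕ → Set
Word = Vec Cell

pattern iOnly = (true , false)
pattern jOnly = (false , true)
pattern both = (true , true)
pattern none = (false , false)

weight : Cell → ℕ
weight (x , y) = b2n x + b2n y

sumI sumJ : ∀ {m} → Word m → ℕ
sumI {m} w = sumFin m (λ r → b2n (proj₁ (lookup w r)))
sumJ {m} w = sumFin m (λ r → b2n (proj₂ (lookup w r)))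

unmatchedJ : ∀ {m} → Word m → ℕ
unmatchedJ [] = 0
unmatchedJ (both ∷ w) = unmatchedJ w
unmatchedJ (iOnly ∷ w) = pred (unmatchedJ w)
unmatchedJ (jOnly ∷ w) = suc (unmatchedJ w)
unmatchedJ (none ∷ w) = unmatchedJ w

unmatchedI : ∀ {m} → Word m → ℕ
unmatchedI [] = 0
unmatchedI (both ∷ w) = unmatchedI w
unmatchedI (iOnly ∷ w) with unmatchedJ w
... | zero = suc (unmatchedI w)
... | suc _ = unmatchedI w
unmatchedI (jOnly ∷ w) = unmatchedI w
unmatchedI (none ∷ w) = unmatchedI w

shift : ∀ {m} → Word m → Word m
shift [] = []
shift (both ∷ w) = both ∷ shift w
shift (iOnly ∷ w) with unmatchedJ w
... | zero = jOnly ∷ w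
... | suc _ = iOnly ∷ shift w
shift (jOnly ∷ w) = jOnly ∷ shift w
shift (none ∷ w) = none ∷ shift w

unshift : ∀ {m} → Word m → Word m
unshift [] = []
unshift (both ∷ w) = both ∷ unshift w
unshift (iOnly ∷ w) = iOnly ∷ unshift w
unshift (jOnly ∷ w) with unmatchedJ w
... | zero = iOnly ∷ w
... | suc _ = jOnly ∷ unshift w
unshift (none ∷ w) = none ∷ unshift w

unmatchedI+sumJ≡unmatchedJ+sumI : ∀ {m} (w : Word m) → unmatchedI w + sumJ w ≡ unmatchedJ w + sumI w
unmatchedI+sumJ≡unmatchedJ+sumI [] = refl
unmatchedI+sumJ≡unmatchedJ+sumI (both ∷ w) = begin
  unmatchedI w + suc (sumJ w)  ≡⟨ +-suc _ _ ⟩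
  suc (unmatchedI w + sumJ w)  ≡⟨ cong suc (unmatchedI+sumJ≡unmatchedJ+sumI w) ⟩
  suc (unmatchedJ w + sumI w)  ≡⟨ +-suc _ _ ⟨
  unmatchedJ w + suc (sumI w)  ∎
  where open ≡-Reasoning
unmatchedI+sumJ≡unmatchedJ+sumI (iOnly ∷ w) with unmatchedJ w | unmatchedI+sumJ≡unmatchedJ+sumI w
... | zero | ih = cong suc ih
... | suc o | ih = trans ih (sym (+-suc o _))
unmatchedI+sumJ≡unmatchedJ+sumI (jOnly ∷ w) = trans (+-suc _ _) (cong suc (unmatchedI+sumJ≡unmatchedJ+sumI w))
unmatchedI+sumJ≡unmatchedJ+sumI (none ∷ w) = unmatchedI+sumJ≡unmatchedJ+sumI w

unmatchedI-pos : ∀ {m} (w : Word m) → sumJ w < sumI w → 0 < unmatchedI w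
unmatchedI-pos w sJ<sI with unmatchedI w | unmatchedI+sumJ≡unmatchedJ+sumI w
... | suc _ | _ = s≤s z≤n
... | zero | sJ≡uJ+sI = contradiction (subst (sumI w ≤_) (sym sJ≡uJ+sI) (m≤n+m _ _)) (<⇒≱ sJ<sI)

unmatchedJ-shift : ∀ {m} (w : Word m) → 0 < unmatchedI w → unmatchedJ (shift w) ≡ suc (unmatchedJ w)
unmatchedJ-shift (both ∷ w) 0<uI = unmatchedJ-shift w 0<uI
unmatchedJ-shift (iOnly ∷ w) 0<uI with unmatchedJ w in uJ≡
... | zero = cong suc uJ≡
... | suc _ = cong pred (trans (unmatchedJ-shift w 0<uI) (cong suc uJ≡))
unmatchedJ-shift (jOnly ∷ w) 0<uI = cong suc (unmatchedJ-shift w 0<uI)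
unmatchedJ-shift (none ∷ w) 0<uI = unmatchedJ-shift w 0<uI

sumI-shift : ∀ {m} (w : Word m) → 0 < unmatchedI w → suc (sumI (shift w)) ≡ sumI w
sumI-shift (both ∷ w) 0<uI = cong suc (sumI-shift w 0<uI)
sumI-shift (iOnly ∷ w) 0<uI with unmatchedJ w
... | zero = refl
... | suc _ = cong suc (sumI-shift w 0<uI)
sumI-shift (jOnly ∷ w) 0<uI = sumI-shift w 0<uI
sumI-shift (none ∷ w) 0<uI = sumI-shift w 0<uI

sumJ-shift : ∀ {m} (w : Word m) → 0 < unmatchedI w → sumJ (shift w) ≡ suc (sumJ w)
sumJ-shift (both ∷ w) 0<uI = cong suc (sumJ-shift w 0<uI)
sumJ-shift (iOnly ∷ w) 0<uI with unmatchedJ w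
... | zero = refl
... | suc _ = sumJ-shift w 0<uI
sumJ-shift (jOnly ∷ w) 0<uI = cong suc (sumJ-shift w 0<uI)
sumJ-shift (none ∷ w) 0<uI = sumJ-shift w 0<uI

weights-shift : ∀ {m} (w : Word m) → map weight (shift w) ≡ map weight w
weights-shift [] = refl
weights-shift (both ∷ w) = cong (2 ∷_) (weights-shift w)
weights-shift (iOnly ∷ w) with unmatchedJ w
... | zero = refl
... | suc _ = cong (1 ∷_) (weights-shift w)
weights-shift (jOnly ∷ w) = cong (1 ∷_) (weights-shift w)
weights-shift (none ∷ w) = cong (0 ∷_) (weights-shift w)

unshift-shift : ∀ {m} (w : Word m) → 0 < unmatchedI w → unshift (shift w) ≡ w
unshift-shift (both ∷ w) 0<uI = cong (both ∷_) (unshift-shift w 0<uI)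
unshift-shift (iOnly ∷ w) 0<uI with unmatchedJ w in uJ≡
... | zero rewrite uJ≡ = refl
... | suc _ = cong (iOnly ∷_) (unshift-shift w 0<uI)
unshift-shift (jOnly ∷ w) 0<uI rewrite unmatchedJ-shift w 0<uI = cong (jOnly ∷_) (unshift-shift w 0<uI)
unshift-shift (none ∷ w) 0<uI = cong (none ∷_) (unshift-shift w 0<uI)

shift-injectiveOn : ∀ {m} {w v : Word m} → 0 < unmatchedI w → 0 < unmatchedI v → shift w ≡ shift v → w ≡ v
shift-injectiveOn {w = w} {v} 0<uIʷ 0<uIᵛ eq = begin
  w                ≡⟨ unshift-shift w 0<uIʷ ⟨
  unshift (shift w) ≡⟨ cong unshift eq ⟩
  unshift (shift v) ≡⟨ unshift-shift v 0<uIᵛ ⟩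
  v                ∎
  where open ≡-Reasoning

record UnitShift {m} (w v : Word m) : Set where
  field
    weights-preserved : map weight v ≡ map weight w
    sumI-decreases : sumI v ≡ pred (sumI w)
    sumJ-increases : sumJ v ≡ suc (sumJ w)

shift-UnitShift : ∀ {m} (w : Word m) → 0 < unmatchedI w → UnitShift w (shift w)
shift-UnitShift w 0<uI = record
  { weights-preserved = weights-shift w
  ; sumI-decreases = cong pred (sumI-shift w 0<uI)
  ; sumJ-increases = sumJ-shift w 0<uI
  }

nBoth nI nJ nActive : ∀ {m} → Word m → ℕ
nBoth [] = 0
nBoth (x ∷ w) = b2n (proj₁ x ∧ proj₂ x) + nBoth w
nI [] = 0
nI (x ∷ w) = b2n (proj₁ x ∧ not (proj₂ x)) + nI w
nJ [] = 0
nJ (x ∷ w) = b2n (not (proj₁ x) ∧ proj₂ x) + nJ w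
nActive [] = 0
nActive (x ∷ w) = b2n (proj₁ x xor proj₂ x) + nActive w

arrange : ∀ {m} → ℕ → Word m → Word m
arrange k [] = []
arrange k (both ∷ w) = both ∷ arrange k w
arrange k (none ∷ w) = none ∷ arrange k w
arrange zero (iOnly ∷ w) = jOnly ∷ arrange zero w
arrange (suc k) (iOnly ∷ w) = iOnly ∷ arrange k w
arrange zero (jOnly ∷ w) = jOnly ∷ arrange zero w
arrange (suc k) (jOnly ∷ w) = iOnly ∷ arrange k w

sumI≡nBoth+nI : ∀ {m} (w : Word m) → sumI w ≡ nBoth w + nI w
sumI≡nBoth+nI [] = refl
sumI≡nBoth+nI (both ∷ w) = cong suc (sumI≡nBoth+nI w)
sumI≡nBoth+nI (iOnly ∷ w) = trans (cong suc (sumI≡nBoth+nI w)) (sym (+-suc _ _))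
sumI≡nBoth+nI (jOnly ∷ w) = sumI≡nBoth+nI w
sumI≡nBoth+nI (none ∷ w) = sumI≡nBoth+nI w

sumJ≡nBoth+nJ : ∀ {m} (w : Word m) → sumJ w ≡ nBoth w + nJ w
sumJ≡nBoth+nJ [] = refl
sumJ≡nBoth+nJ (both ∷ w) = cong suc (sumJ≡nBoth+nJ w)
sumJ≡nBoth+nJ (iOnly ∷ w) = sumJ≡nBoth+nJ w
sumJ≡nBoth+nJ (jOnly ∷ w) = trans (cong suc (sumJ≡nBoth+nJ w)) (sym (+-suc _ _))
sumJ≡nBoth+nJ (none ∷ w) = sumJ≡nBoth+nJ w

nActive≡nI+nJ : ∀ {m} (w : Word m) → nActive w ≡ nI w + nJ w
nActive≡nI+nJ [] = refl
nActive≡nI+nJ (both ∷ w) = nActive≡nI+nJ w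
nActive≡nI+nJ (iOnly ∷ w) = cong suc (nActive≡nI+nJ w)
nActive≡nI+nJ (jOnly ∷ w) = trans (cong suc (nActive≡nI+nJ w)) (sym (+-suc _ _))
nActive≡nI+nJ (none ∷ w) = nActive≡nI+nJ w

sumI-arrange : ∀ {m} k (w : Word m) → k ≤ nActive w → sumI (arrange k w) ≡ nBoth w + k
sumI-arrange k [] z≤n = refl
sumI-arrange k (both ∷ w) k≤nA = cong suc (sumI-arrange k w k≤nA)
sumI-arrange k (none ∷ w) k≤nA = sumI-arrange k w k≤nA
sumI-arrange zero (iOnly ∷ w) _ = sumI-arrange zero w z≤n
sumI-arrange (suc k) (iOnly ∷ w) (s≤s k≤nA) = trans (cong suc (sumI-arrange k w k≤nA)) (sym (+-suc _ _))
sumI-arrange zero (jOnly ∷ w) _ = sumI-arrange zero w z≤n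
sumI-arrange (suc k) (jOnly ∷ w) (s≤s k≤nA) = trans (cong suc (sumI-arrange k w k≤nA)) (sym (+-suc _ _))

sumJ-arrange : ∀ {m} k (w : Word m) → k ≤ nActive w → sumJ (arrange k w) + k ≡ nBoth w + nActive w
sumJ-arrange k [] z≤n = refl
sumJ-arrange k (both ∷ w) k≤nA = cong suc (sumJ-arrange k w k≤nA)
sumJ-arrange k (none ∷ w) k≤nA = sumJ-arrange k w k≤nA
sumJ-arrange zero (iOnly ∷ w) _ = trans (cong suc (sumJ-arrange zero w z≤n)) (sym (+-suc _ _))
sumJ-arrange (suc k) (iOnly ∷ w) (s≤s k≤nA) = trans (+-suc _ k) (trans (cong suc (sumJ-arrange k w k≤nA)) (sym (+-suc _ _)))
sumJ-arrange zero (jOnly ∷ w) _ = trans (cong suc (sumJ-arrange zero w z≤n)) (sym (+-suc _ _))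
sumJ-arrange (suc k) (jOnly ∷ w) (s≤s k≤nA) = trans (+-suc _ k) (trans (cong suc (sumJ-arrange k w k≤nA)) (sym (+-suc _ _)))

unmatchedJ-arrange : ∀ {m} k (w : Word m) → unmatchedJ (arrange k w) ≡ nActive w ∸ k ∸ k
unmatchedJ-arrange k [] = sym (trans (cong (_∸ k) (0∸n≡0 k)) (0∸n≡0 k))
unmatchedJ-arrange k (both ∷ w) = unmatchedJ-arrange k w
unmatchedJ-arrange k (none ∷ w) = unmatchedJ-arrange k w
unmatchedJ-arrange zero (iOnly ∷ w) = cong suc (unmatchedJ-arrange zero w)
unmatchedJ-arrange (suc k) (iOnly ∷ w) = trans (cong pred (unmatchedJ-arrange k w)) (pred[m∸n]≡m∸[1+n] _ k)
unmatchedJ-arrange zero (jOnly ∷ w) = cong suc (unmatchedJ-arrange zero w)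
unmatchedJ-arrange (suc k) (jOnly ∷ w) = trans (cong pred (unmatchedJ-arrange k w)) (pred[m∸n]≡m∸[1+n] _ k)

weights-arrange : ∀ {m} k (w : Word m) → map weight (arrange k w) ≡ map weight w
weights-arrange k [] = refl
weights-arrange k (both ∷ w) = cong (2 ∷_) (weights-arrange k w)
weights-arrange k (none ∷ w) = cong (0 ∷_) (weights-arrange k w)
weights-arrange zero (iOnly ∷ w) = cong (1 ∷_) (weights-arrange zero w)
weights-arrange (suc k) (iOnly ∷ w) = cong (1 ∷_) (weights-arrange k w)
weights-arrange zero (jOnly ∷ w) = cong (1 ∷_) (weights-arrange zero w)
weights-arrange (suc k) (jOnly ∷ w) = cong (1 ∷_) (weights-arrange k w)

nJ-gap : ∀ {m} (w : Word m) → suc (sumJ w) < sumI w → suc (nJ w) < nI w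
nJ-gap w gap = +-cancelˡ-≤ (nBoth w) _ _ (subst₂ _≤_ sumJ-eq (sumI≡nBoth+nI w) gap)
  where
  sumJ-eq : 2 + sumJ w ≡ nBoth w + (2 + nJ w)
  sumJ-eq = trans (cong (2 +_) (sumJ≡nBoth+nJ w)) (regroup (nBoth w) (nJ w))
    where
    regroup : ∀ b j → 2 + (b + j) ≡ b + (2 + j)
    regroup = solve-∀

balanced-UnitShift : ∀ {m} (w : Word m) → suc (sumJ w) < sumI w →
  ∃ λ v → UnitShift w v × unmatchedJ v ≡ 0
balanced-UnitShift w gap with nI w in nI≡ | nJ-gap w gap
... | suc p | s≤s nJ<p = arrange p w , shifted , balanced
  where
  nActive≡ : nActive w ≡ suc p + nJ w
  nActive≡ = trans (nActive≡nI+nJ w) (cong (_+ nJ w) nI≡)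
  p≤nActive : p ≤ nActive w
  p≤nActive = subst (p ≤_) (sym nActive≡) (≤-trans (n≤1+n p) (m≤m+n _ _))
  shifted : UnitShift w (arrange p w)
  shifted = record
    { weights-preserved = weights-arrange p w
    ; sumI-decreases = begin
        sumI (arrange p w)       ≡⟨ sumI-arrange p w p≤nActive ⟩
        nBoth w + p              ≡⟨ cong pred (+-suc (nBoth w) p) ⟨
        pred (nBoth w + suc p)   ≡⟨ cong (λ x → pred (nBoth w + x)) nI≡ ⟨
        pred (nBoth w + nI w)    ≡⟨ cong pred (sumI≡nBoth+nI w) ⟨
        pred (sumI w)            ∎
    ; sumJ-increases = +-cancelʳ-≡ p _ _ (begin
        sumJ (arrange p w) + p       ≡⟨ sumJ-arrange p w p≤nActive ⟩
        nBoth w + nActive w          ≡⟨ cong (nBoth w +_) nActive≡ ⟩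
        nBoth w + (suc p + nJ w)     ≡⟨ regroup (nBoth w) p (nJ w) ⟩
        suc (nBoth w + nJ w) + p     ≡⟨ cong (λ x → suc x + p) (sumJ≡nBoth+nJ w) ⟨
        suc (sumJ w) + p             ∎)
    }
    where
    open ≡-Reasoning
    regroup : ∀ b p j → b + (suc p + j) ≡ suc (b + j) + p
    regroup = solve-∀
  balanced : unmatchedJ (arrange p w) ≡ 0
  balanced = begin
    unmatchedJ (arrange p w)       ≡⟨ unmatchedJ-arrange p w ⟩
    nActive w ∸ p ∸ p              ≡⟨ cong (λ x → x ∸ p ∸ p) (trans nActive≡ (sym (+-suc p (nJ w)))) ⟩
    p + suc (nJ w) ∸ p ∸ p         ≡⟨ cong (_∸ p) (m+n∸m≡n p (suc (nJ w))) ⟩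
    suc (nJ w) ∸ p                 ≡⟨ m≤n⇒m∸n≡0 nJ<p ⟩
    0                              ∎
    where open ≡-Reasoning

-- Replacing two columns of a matrix

sumFin-cong : ∀ n {f g : Fin n → ℕ} → (∀ c → f c ≡ g c) → sumFin n f ≡ sumFin n g
sumFin-cong zero _ = refl
sumFin-cong (suc n) f≗g = cong₂ _+_ (f≗g zero) (sumFin-cong n (f≗g ∘ suc))

sumFin-exchange : ∀ n (f g : Fin n → ℕ) k → (∀ c → c ≢ k → f c ≡ g c) →
  sumFin n f + g k ≡ sumFin n g + f k
sumFin-exchange (suc n) f g zero f≗g rewrite sumFin-cong n (λ c → f≗g (suc c) λ ()) =
  swap-ends (f zero) _ (g zero)
  where
  swap-ends : ∀ x s y → x + s + y ≡ y + s + x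
  swap-ends = solve-∀
sumFin-exchange (suc n) f g (suc k) f≗g rewrite f≗g zero (λ ()) = begin
  g zero + sumFin n (f ∘ suc) + g (suc k)    ≡⟨ +-assoc (g zero) _ _ ⟩
  g zero + (sumFin n (f ∘ suc) + g (suc k))  ≡⟨ cong (g zero +_) (sumFin-exchange n (f ∘ suc) (g ∘ suc) k
                                                  λ c c≢k → f≗g (suc c) (c≢k ∘ suc-injective)) ⟩
  g zero + (sumFin n (g ∘ suc) + f (suc k))  ≡⟨ +-assoc (g zero) _ _ ⟨
  g zero + sumFin n (g ∘ suc) + f (suc k)    ∎
  where open ≡-Reasoning

sumFin-cong-except₂ : ∀ n (f g : Fin n → ℕ) {i j} → i ≢ j → (∀ c → c ≢ i → c ≢ j → f c ≡ g c) →
  f i + f j ≡ g i + g j → sumFin n f ≡ sumFin n g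
sumFin-cong-except₂ n f g {i} {j} i≢j f≗g pair≡ = +-cancelʳ-≡ (g i + g j) _ _ (begin
  sumFin n f + (g i + g j)   ≡⟨ +-assoc (sumFin n f) _ _ ⟨
  sumFin n f + g i + g j     ≡⟨ cong (λ x → sumFin n f + x + g j) (updateAt-updates i f) ⟨
  sumFin n f + h i + g j     ≡⟨ cong (_+ g j) (sumFin-exchange n f h i f≗h) ⟩
  sumFin n h + f i + g j     ≡⟨ swap-last (sumFin n h) (f i) (g j) ⟩
  sumFin n h + g j + f i     ≡⟨ cong (_+ f i) (sumFin-exchange n h g j h≗g) ⟩
  sumFin n g + h j + f i     ≡⟨ cong (λ x → sumFin n g + x + f i) (updateAt-minimal j i f (i≢j ∘ sym)) ⟩
  sumFin n g + f j + f i     ≡⟨ swap-last (sumFin n g) (f j) (f i) ⟩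
  sumFin n g + f i + f j     ≡⟨ +-assoc (sumFin n g) _ _ ⟩
  sumFin n g + (f i + f j)   ≡⟨ cong (sumFin n g +_) pair≡ ⟩
  sumFin n g + (g i + g j)   ∎)
  where
  open ≡-Reasoning
  h : Fin n → ℕ
  h = Vector.updateAt f i (const (g i))
  f≗h : ∀ c → c ≢ i → f c ≡ h c
  f≗h c c≢i = sym (updateAt-minimal c i f c≢i)
  h≗g : ∀ c → c ≢ j → h c ≡ g c
  h≗g c c≢j with c ≟ i
  ... | yes refl = updateAt-updates i f
  ... | no c≢i = trans (updateAt-minimal c i f c≢i) (f≗g c c≢i c≢j)
  swap-last : ∀ s x y → s + x + y ≡ s + y + x
  swap-last = solve-∀

Matrix-ext : ∀ {n} {M N : Matrix n} → (∀ r c → entry M r c ≡ entry N r c) → M ≡ N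
Matrix-ext M≗N = Pointwise-≡⇒≡ (ext λ r → Pointwise-≡⇒≡ (ext (M≗N r)))

columns : ∀ {n} → Fin n → Fin n → Matrix n → Word n
columns i j M = tabulate λ r → entry M r i , entry M r j

override : ∀ {n} → Fin n → Fin n → Cell → Bool → Fin n → Bool
override i j (x , y) b c with c ≟ i | c ≟ j
... | yes _ | _     = x
... | no _  | yes _ = y
... | no _  | no _  = b

withColumns : ∀ {n} → Fin n → Fin n → Matrix n → Word n → Matrix n
withColumns i j M v = tabulate λ r → tabulate λ c → override i j (lookup v r) (entry M r c) c

module _ {n} {i j : Fin n} where

  override-i : ∀ x b → override i j x b i ≡ proj₁ x
  override-i x b with i ≟ i
  ... | yes _ = refl
  ... | no i≢i = contradiction refl i≢i

  override-j : i ≢ j → ∀ x b → override i j x b j ≡ proj₂ x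
  override-j i≢j x b with j ≟ i | j ≟ j
  ... | yes j≡i | _ = contradiction (sym j≡i) i≢j
  ... | no _ | yes _ = refl
  ... | no _ | no j≢j = contradiction refl j≢j

  override-other : ∀ {c} → c ≢ i → c ≢ j → ∀ x b → override i j x b c ≡ b
  override-other {c} c≢i c≢j x b with c ≟ i | c ≟ j
  ... | yes c≡i | _ = contradiction c≡i c≢i
  ... | no _ | yes c≡j = contradiction c≡j c≢j
  ... | no _ | no _ = refl

  override-self : ∀ (b : Fin n → Bool) c → override i j (b i , b j) (b c) c ≡ b c
  override-self b c with c ≟ i | c ≟ j
  ... | yes refl | _ = refl
  ... | no _ | yes refl = refl
  ... | no _ | no _ = refl

  override-override : ∀ x y b c → override i j x (override i j y b c) c ≡ override i j x b c
  override-override x y b c with c ≟ i | c ≟ j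
  ... | yes _ | _ = refl
  ... | no _ | yes _ = refl
  ... | no _ | no _ = refl

  entry-withColumns : ∀ M v r c → entry (withColumns i j M v) r c ≡ override i j (lookup v r) (entry M r c) c
  entry-withColumns M v r c = trans (cong (λ row → lookup row c) (lookup∘tabulate _ r)) (lookup∘tabulate _ c)

  lookup-columns : ∀ M r → lookup (columns i j M) r ≡ (entry M r i , entry M r j)
  lookup-columns M r = lookup∘tabulate _ r

  columns-withColumns : i ≢ j → ∀ M v → columns i j (withColumns i j M v) ≡ v
  columns-withColumns i≢j M v = Pointwise-≡⇒≡ (ext λ r → begin
    lookup (columns i j (withColumns i j M v)) r  ≡⟨ lookup-columns (withColumns i j M v) r ⟩
    (entry (withColumns i j M v) r i , entry (withColumns i j M v) r j)
      ≡⟨ cong₂ _,_ (trans (entry-withColumns M v r i) (override-i _ _))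
                   (trans (entry-withColumns M v r j) (override-j i≢j _ _)) ⟩
    lookup v r                                     ∎)
    where open ≡-Reasoning

  withColumns-columns : ∀ M → withColumns i j M (columns i j M) ≡ M
  withColumns-columns M = Matrix-ext λ r c → begin
    entry (withColumns i j M (columns i j M)) r c                 ≡⟨ entry-withColumns M (columns i j M) r c ⟩
    override i j (lookup (columns i j M) r) (entry M r c) c      ≡⟨ cong (λ x → override i j x (entry M r c) c) (lookup-columns M r) ⟩
    override i j (entry M r i , entry M r j) (entry M r c) c     ≡⟨ override-self (entry M r) c ⟩
    entry M r c                                                   ∎
    where open ≡-Reasoning

  withColumns-withColumns : ∀ M v u → withColumns i j (withColumns i j M v) u ≡ withColumns i j M u
  withColumns-withColumns M v u = Matrix-ext λ r c → begin
    entry (withColumns i j (withColumns i j M v) u) r c                   ≡⟨ entry-withColumns (withColumns i j M v) u r c ⟩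
    override i j (lookup u r) (entry (withColumns i j M v) r c) c         ≡⟨ cong (λ b → override i j (lookup u r) b c) (entry-withColumns M v r c) ⟩
    override i j (lookup u r) (override i j (lookup v r) (entry M r c) c) c ≡⟨ override-override (lookup u r) (lookup v r) (entry M r c) c ⟩
    override i j (lookup u r) (entry M r c) c                              ≡⟨ entry-withColumns M u r c ⟨
    entry (withColumns i j M u) r c                                        ∎
    where open ≡-Reasoning

  sumI-columns : ∀ M → sumI (columns i j M) ≡ lookup (colSums M) i
  sumI-columns M = trans (sumFin-cong n λ r → cong (b2n ∘ proj₁) (lookup-columns M r)) (sym (lookup∘tabulate _ i))

  sumJ-columns : ∀ M → sumJ (columns i j M) ≡ lookup (colSums M) j
  sumJ-columns M = trans (sumFin-cong n λ r → cong (b2n ∘ proj₂) (lookup-columns M r)) (sym (lookup∘tabulate _ j))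

  rowSums-withColumns : i ≢ j → ∀ M v → map weight v ≡ map weight (columns i j M) →
    rowSums (withColumns i j M v) ≡ rowSums M
  rowSums-withColumns i≢j M v weights≡ = tabulate-cong λ r →
    sumFin-cong-except₂ n _ _ i≢j
      (λ c c≢i c≢j → cong b2n (trans (entry-withColumns M v r c) (override-other c≢i c≢j _ _)))
      (begin
        b2n (entry W r i) + b2n (entry W r j)
          ≡⟨ cong₂ (λ x y → b2n x + b2n y) (trans (entry-withColumns M v r i) (override-i _ _))
                                             (trans (entry-withColumns M v r j) (override-j i≢j _ _)) ⟩
        weight (lookup v r)                      ≡⟨ lookup-map r weight v ⟨
        lookup (map weight v) r                  ≡⟨ cong (λ ws → lookup ws r) weights≡ ⟩
        lookup (map weight (columns i j M)) r    ≡⟨ lookup-map r weight (columns i j M) ⟩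
        weight (lookup (columns i j M) r)        ≡⟨ cong weight (lookup-columns M r) ⟩
        b2n (entry M r i) + b2n (entry M r j)    ∎)
    where
    open ≡-Reasoning
    W = withColumns i j M v

  colSums-withColumns : i ≢ j → ∀ M v → sumI v ≡ pred (sumI (columns i j M)) → sumJ v ≡ suc (sumJ (columns i j M)) →
    colSums (withColumns i j M v) ≡ (colSums M [ i ]%= pred) [ j ]%= suc
  colSums-withColumns i≢j M v sumI≡ sumJ≡ = Pointwise-≡⇒≡ (ext column)
    where
    cs = colSums M
    entry≡ : ∀ c r → entry (withColumns i j M v) r c ≡ override i j (lookup v r) (entry M r c) c
    entry≡ c r = entry-withColumns M v r c
    column : ∀ c → lookup (colSums (withColumns i j M v)) c ≡ lookup ((cs [ i ]%= pred) [ j ]%= suc) c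
    column c with c ≟ i | c ≟ j
    ... | yes refl | _ = begin
      lookup (colSums (withColumns i j M v)) i   ≡⟨ lookup∘tabulate _ i ⟩
      _                                          ≡⟨ sumFin-cong n (λ r → cong b2n (trans (entry≡ i r) (override-i _ _))) ⟩
      sumI v                                     ≡⟨ trans sumI≡ (cong pred (sumI-columns M)) ⟩
      pred (lookup cs i)                         ≡⟨ lookup∘updateAt i cs ⟨
      lookup (cs [ i ]%= pred) i                 ≡⟨ lookup∘updateAt′ i j i≢j (cs [ i ]%= pred) ⟨
      lookup ((cs [ i ]%= pred) [ j ]%= suc) i  ∎
      where open ≡-Reasoning
    ... | no c≢i | yes refl = begin
      lookup (colSums (withColumns i j M v)) j   ≡⟨ lookup∘tabulate _ j ⟩
      _                                          ≡⟨ sumFin-cong n (λ r → cong b2n (trans (entry≡ j r) (override-j i≢j _ _))) ⟩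
      sumJ v                                     ≡⟨ trans sumJ≡ (cong suc (sumJ-columns M)) ⟩
      suc (lookup cs j)                          ≡⟨ cong suc (lookup∘updateAt′ j i c≢i cs) ⟨
      suc (lookup (cs [ i ]%= pred) j)           ≡⟨ lookup∘updateAt j (cs [ i ]%= pred) ⟨
      lookup ((cs [ i ]%= pred) [ j ]%= suc) j  ∎
      where open ≡-Reasoning
    ... | no c≢i | no c≢j = begin
      lookup (colSums (withColumns i j M v)) c   ≡⟨ lookup∘tabulate _ c ⟩
      _                                          ≡⟨ sumFin-cong n (λ r → cong b2n (trans (entry≡ c r) (override-other c≢i c≢j _ _))) ⟩
      _                                          ≡⟨ lookup∘tabulate _ c ⟨
      lookup cs c                                ≡⟨ lookup∘updateAt′ c i c≢i cs ⟨
      lookup (cs [ i ]%= pred) c                 ≡⟨ lookup∘updateAt′ c j c≢j (cs [ i ]%= pred) ⟨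
      lookup ((cs [ i ]%= pred) [ j ]%= suc) c  ∎
      where open ≡-Reasoning

  withColumns-realizes : i ≢ j → ∀ {a b} M {v} → IsRealization a b M → UnitShift (columns i j M) v →
    IsRealization ((a [ i ]%= pred) [ j ]%= suc) b (withColumns i j M v)
  withColumns-realizes i≢j M {v} (cols≡a , rows≡b) v-shift =
    trans (colSums-withColumns i≢j M v sumI-decreases sumJ-increases) (cong (λ a → (a [ i ]%= pred) [ j ]%= suc) cols≡a) ,
    trans (rowSums-withColumns i≢j M v weights-preserved) rows≡b
    where open UnitShift v-shift

-- The transfer map

module Transfer {n} {a b : Vec ℕ n} {i j : Fin n} (i≢j : i ≢ j) (gap : lookup a j + 2 ≤ lookup a i) where

  a⁺ : Vec ℕ n
  a⁺ = (a [ i ]%= pred) [ j ]%= suc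

  column-gap : ∀ M → IsRealization a b M → suc (sumJ (columns i j M)) < sumI (columns i j M)
  column-gap M (cols≡a , _) = subst₂ (λ x y → suc x < y)
    (sym (trans (sumJ-columns M) (cong (λ cs → lookup cs j) cols≡a)))
    (sym (trans (sumI-columns M) (cong (λ cs → lookup cs i) cols≡a)))
    (subst (_≤ lookup a i) (+-comm (lookup a j) 2) gap)

  unmatchedI-columns-pos : ∀ M → IsRealization a b M → 0 < unmatchedI (columns i j M)
  unmatchedI-columns-pos M r = unmatchedI-pos (columns i j M) (<⇒≤ (column-gap M r))

  transfer : Matrix n → Matrix n
  transfer M = withColumns i j M (shift (columns i j M))

  transfer-realizes : ∀ {M} → IsRealization a b M → IsRealization a⁺ b (transfer M)
  transfer-realizes {M} r = withColumns-realizes i≢j M r (shift-UnitShift (columns i j M) (unmatchedI-columns-pos M r))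

  columns-transfer : ∀ M → columns i j (transfer M) ≡ shift (columns i j M)
  columns-transfer M = columns-withColumns i≢j M (shift (columns i j M))

  transfer-injective : ∀ {M M′} → IsRealization a b M → IsRealization a b M′ → transfer M ≡ transfer M′ → M ≡ M′
  transfer-injective {M} {M′} r r′ eq = begin
    M                                               ≡⟨ withColumns-columns M ⟨
    withColumns i j M (columns i j M)               ≡⟨ withColumns-withColumns M (shift (columns i j M)) (columns i j M) ⟨
    withColumns i j (transfer M) (columns i j M)    ≡⟨ cong₂ (withColumns i j) eq columns≡ ⟩
    withColumns i j (transfer M′) (columns i j M′)  ≡⟨ withColumns-withColumns M′ (shift (columns i j M′)) (columns i j M′) ⟩
    withColumns i j M′ (columns i j M′)             ≡⟨ withColumns-columns M′ ⟩
    M′                                              ∎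
    where
    open ≡-Reasoning
    columns≡ : columns i j M ≡ columns i j M′
    columns≡ = shift-injectiveOn (unmatchedI-columns-pos M r) (unmatchedI-columns-pos M′ r′)
      (trans (sym (columns-transfer M)) (trans (cong (columns i j) eq) (columns-transfer M′)))

  realization-outside-image : ∀ M → IsRealization a b M →
    Σ (Matrix n) λ M⁺ → IsRealization a⁺ b M⁺ × (∀ M′ → IsRealization a b M′ → transfer M′ ≢ M⁺)
  realization-outside-image M r with balanced-UnitShift (columns i j M) (column-gap M r)
  ... | v , v-shift , v-balanced = withColumns i j M v , withColumns-realizes i≢j M r v-shift , not-transfer
    where
    not-transfer : ∀ M′ → IsRealization a b M′ → transfer M′ ≢ withColumns i j M v
    not-transfer M′ r′ eq = contradiction (begin
      suc (unmatchedJ (columns i j M′))        ≡⟨ unmatchedJ-shift (columns i j M′) (unmatchedI-columns-pos M′ r′) ⟨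
      unmatchedJ (shift (columns i j M′))      ≡⟨ cong unmatchedJ (columns-transfer M′) ⟨
      unmatchedJ (columns i j (transfer M′))   ≡⟨ cong (unmatchedJ ∘ columns i j) eq ⟩
      unmatchedJ (columns i j (withColumns i j M v)) ≡⟨ cong unmatchedJ (columns-withColumns i≢j M v) ⟩
      unmatchedJ v                             ≡⟨ v-balanced ⟩
      0                                        ∎) λ ()
      where open ≡-Reasoning

  private
    open FilterInjection (isRealization? a b) (isRealization? a⁺ b) (Unique-allMatrices n) ∈-allMatrices
      transfer (λ {M} → transfer-realizes {M}) (λ {M M′} → transfer-injective {M} {M′})

  N₁-transfer-≤ : N₁ a b ≤ N₁ a⁺ b
  N₁-transfer-≤ = length-filter-≤

  N₁-transfer-< : LoopDigraphic a b → N₁ a b < N₁ a⁺ b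
  N₁-transfer-< (M , r) =
    let M⁺ , r⁺ , M⁺∉image = realization-outside-image M r in length-filter-< M⁺ r⁺ M⁺∉image

theorem10 : (n : ℕ) (a a' b : Vec ℕ n) (i j : Fin n) →
    a ≢ a' → UnitTransfer i j a' a →
    (N₁ a' b ≤ N₁ a b) × (LoopDigraphic a' b → N₁ a' b < N₁ a b)
theorem10 n _ a' b i j _ (i<j , gap , refl) = N₁-transfer-≤ , N₁-transfer-<
  where open Transfer {a = a'} {b} (<⇒≢ i<j) gap
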